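{- Let $H$ be a graph and let $k$ be its degeneracy. Then $$AR_d(H) \leq k\, e(H) - k + v(H) - 1.$$
   Context: All graphs are finite and simple; $v(H)$ and $e(H)$ denote the numbers of vertices and edges of $H$. A proper edge colouring assigns colours to edges so that edges sharing a vertex receive distinct colours. A copy of $H$ in an edge-coloured graph is rainbow if all its edges have distinct colours. The degree anti-Ramsey number $AR_d(H)$ is the smallest integer $k$ for which there exists a graph $G$ with maximum degree at most $k$ such that every proper edge colouring of $G$ contains a rainbow copy of $H$. The degeneracy of a graph $H$ is the smallest integer $d$ for which there is an ordering $v_1,\dots,v_n$ of $V(H)$ such that $|\{1 \le j < i : v_jv_i \in E(H)\}| \le d$ for every $1 \le i \le n$. -}

module Defs where

open import Data.Nat using (ℕ; zero; suc; _+_; _*_; _∸_; _≤_; _<ᵇ_)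
open import Data.Bool using (Bool; true; false; _∧_; if_then_else_)
open import Data.Fin using (Fin; toℕ) renaming (zero to fzero; suc to fsuc)
open import Data.Product using (Σ; _×_; _,_)
open import Data.Sum using (_⊎_)
open import Relation.Binary.PropositionalEquality using (_≡_; _≢_)
open import Function.Definitions using (Injective)

count : ∀ {n} → (Fin n → Bool) → ℕ
count {zero}  p = 0
count {suc n} p = (if p fzero then 1 else 0) + count (λ i → p (fsuc i))

sumF : ∀ {n} → (Fin n → ℕ) → ℕ
sumF {zero}  f = 0
sumF {suc n} f = f fzero + sumF (λ i → f (fsuc i))

record Graph : Set where
  field
    V       : ℕ
    adj     : Fin V → Fin V → Bool
    symm    : ∀ x y → adj x y ≡ adj y x
    irrefl  : ∀ x → adj x x ≡ false

open Graph public

v : Graph → ℕ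
v H = V H

e : Graph → ℕ
e H = sumF (λ i → count (λ j → (toℕ i <ᵇ toℕ j) ∧ adj H i j))

degree : (G : Graph) → Fin (V G) → ℕ
degree G x = count (λ y → adj G x y)

MaxDegreeAtMost : Graph → ℕ → Set
MaxDegreeAtMost G D = ∀ x → degree G x ≤ D

Adj : (G : Graph) → Fin (V G) → Fin (V G) → Set
Adj G x y = adj G x y ≡ true

-- An edge colouring with colours in ℕ: a colour for each (ordered) pair,
-- required to be symmetric on edges (so it is a colouring of unordered edges).
record EdgeColouring (G : Graph) : Set where
  field
    col  : Fin (V G) → Fin (V G) → ℕ
    csym : ∀ x y → Adj G x y → col x y ≡ col y x

open EdgeColouring public

Proper : {G : Graph} → EdgeColouring G → Set
Proper {G} c = ∀ x y z → Adj G x y → Adj G x z → y ≢ z → col c x y ≢ col c x z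

-- A rainbow copy of H in G under colouring c: an injective vertex map
-- sending edges of H to edges of G, with distinct H-edges receiving
-- distinct colours.
RainbowCopy : (H G : Graph) → EdgeColouring G → Set
RainbowCopy H G c =
  Σ (Fin (V H) → Fin (V G)) λ φ →
    Injective _≡_ _≡_ φ ×
    (∀ x y → Adj H x y → Adj G (φ x) (φ y)) ×
    (∀ x y x' y' → Adj H x y → Adj H x' y' →
       col c (φ x) (φ y) ≡ col c (φ x') (φ y') →
       (x ≡ x' × y ≡ y') ⊎ (x ≡ y' × y ≡ x'))

ForcesRainbow : Graph → Graph → Set
ForcesRainbow G H = (c : EdgeColouring G) → Proper c → RainbowCopy H G c

-- AR_d(H) ≤ D  (unfolding "smallest k such that some G with Δ(G) ≤ k forces a
-- rainbow H" : the minimum is ≤ D iff some G with Δ(G) ≤ D forces a rainbow H).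
ARdAtMost : Graph → ℕ → Set
ARdAtMost H D = Σ Graph λ G → MaxDegreeAtMost G D × ForcesRainbow G H

-- H has an ordering (given by an injective σ : Fin v → Fin v, vertex σ i at
-- position i) in which every vertex has at most d earlier neighbours.
HasDegenOrdering : Graph → ℕ → Set
HasDegenOrdering H d =
  Σ (Fin (V H) → Fin (V H)) λ σ →
    Injective _≡_ _≡_ σ ×
    (∀ i → count (λ j → (toℕ j <ᵇ toℕ i) ∧ adj H (σ j) (σ i)) ≤ d)

IsDegeneracy : Graph → ℕ → Set
IsDegeneracy H k = HasDegenOrdering H k × (∀ d → HasDegenOrdering H d → k ≤ d)

module Submission where

-- Put D = k·e(H) − k + v(H) − 1:
-- the complete graph K_{D+1} has maximum degree D, and every proper colouring
-- of it contains a rainbow H, found by embedding H greedily along the ordering.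
-- When the next vertex u is placed, an image w is forbidden if it is already
-- used (fewer than v(H) such w), or if for an embedded neighbour y of u (at
-- most k of them) the edge φ(y)w repeats the colour of an embedded edge (fewer
-- than e(H) of them, as yu is not embedded yet); properness at φ(y) makes each
-- such pair forbid at most one w. So at most D images are forbidden, one is free.

open import Defs
open import Data.Nat using (ℕ; zero; suc; pred; _+_; _*_; _∸_; _≤_; _<_; _<ᵇ_; _<?_; z≤n; s≤s; z<s; _≟_)
open import Data.Nat.Properties
open import Data.Bool using (Bool; true; false; _∧_; _∨_; not; if_then_else_)
open import Data.Bool.Properties using (∧-conicalˡ; ∧-conicalʳ; ∨-conicalˡ; ∨-conicalʳ; ∧-zeroʳ)
open import Data.Fin using (Fin; toℕ; fromℕ<; punchOut) renaming (zero to fzero; suc to fsuc)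
open import Data.Fin.Properties using (toℕ-injective; toℕ-fromℕ<; toℕ<n; any?; punchOut-injective; injective⇒≤)
  renaming (_≟_ to _≟ᶠ_; suc-injective to fsuc-injective)
open import Data.Fin.Permutation using (Permutation; permutation; _⟨$⟩ʳ_; _⟨$⟩ˡ_; inverseˡ; inverseʳ)
open import Algebra.Properties.CommutativeMonoid.Sum +-0-commutativeMonoid using (sum; ∑-permute)
open import Data.Product using (∃; _×_; _,_; proj₁; proj₂)
open import Data.Sum using (_⊎_; inj₁; inj₂)
open import Data.Empty using (⊥-elim)
open import Relation.Nullary using (¬_; Dec; yes; no; does; contradiction)
open import Relation.Nullary.Decidable using (dec-true; dec-false; does-⇔)
open import Relation.Binary.PropositionalEquality
open import Relation.Binary.Definitions using (tri<; tri≈; tri>)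
open import Algebra.Properties.CommutativeSemigroup +-commutativeSemigroup using (interchange)
open import Function.Definitions using (Injective)
open import Function.Bundles using (mk⇔)

does⇒ : ∀ {a} {A : Set a} (a? : Dec A) → does a? ≡ true → A
does⇒ (yes a) _ = a

¬does⇒ : ∀ {a} {A : Set a} (a? : Dec A) → does a? ≡ false → ¬ A
¬does⇒ (no ¬a) _ = ¬a

true≢false : true ≢ false
true≢false ()

not-true : ∀ {b} → not b ≡ true → b ≡ false
not-true {false} _ = refl

ind : Bool → ℕ
ind b = if b then 1 else 0

anyF : ∀ {n} → (Fin n → Bool) → Bool
anyF {zero}  p = false
anyF {suc n} p = p fzero ∨ anyF (λ i → p (fsuc i))

anyF-false : ∀ {n} (p : Fin n → Bool) → anyF p ≡ false → ∀ i → p i ≡ false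
anyF-false {suc n} p h fzero    = ∨-conicalˡ (p fzero) _ h
anyF-false {suc n} p h (fsuc i) = anyF-false (λ j → p (fsuc j)) (∨-conicalʳ (p fzero) _ h) i

sumF-mono : ∀ {n} {f g : Fin n → ℕ} → (∀ i → f i ≤ g i) → sumF f ≤ sumF g
sumF-mono {zero}  h = z≤n
sumF-mono {suc n} h = +-mono-≤ (h fzero) (sumF-mono (λ i → h (fsuc i)))

sumF-strict : ∀ {n} {f g : Fin n → ℕ} → (∀ i → f i ≤ g i) → ∀ i₀ → f i₀ < g i₀ → sumF f < sumF g
sumF-strict {suc n} h fzero     lt = +-mono-<-≤ lt (sumF-mono (λ i → h (fsuc i)))
sumF-strict {suc n} h (fsuc i₀) lt = +-mono-≤-< (h fzero) (sumF-strict (λ i → h (fsuc i)) i₀ lt)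

sumF≡sum : ∀ {n} (f : Fin n → ℕ) → sumF f ≡ sum f
sumF≡sum {zero}  f = refl
sumF≡sum {suc n} f = cong (f fzero +_) (sumF≡sum (λ i → f (fsuc i)))

count≡sumF : ∀ {n} (p : Fin n → Bool) → count p ≡ sumF (λ i → ind (p i))
count≡sumF {zero}  p = refl
count≡sumF {suc n} p = cong (ind (p fzero) +_) (count≡sumF (λ i → p (fsuc i)))

count-permute : ∀ {n} (p : Fin n → Bool) (ρ : Permutation n n) → count p ≡ count (λ j → p (ρ ⟨$⟩ʳ j))
count-permute p ρ = begin
  count p                              ≡⟨ count≡sumF p ⟩
  sumF (λ i → ind (p i))               ≡⟨ sumF≡sum (λ i → ind (p i)) ⟩
  sum (λ i → ind (p i))                ≡⟨ ∑-permute (λ i → ind (p i)) ρ ⟩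
  sum (λ j → ind (p (ρ ⟨$⟩ʳ j)))       ≡⟨ sumF≡sum (λ j → ind (p (ρ ⟨$⟩ʳ j))) ⟨
  sumF (λ j → ind (p (ρ ⟨$⟩ʳ j)))      ≡⟨ count≡sumF (λ j → p (ρ ⟨$⟩ʳ j)) ⟨
  count (λ j → p (ρ ⟨$⟩ʳ j))           ∎
  where open ≡-Reasoning

ind-mono : ∀ {b c} → (b ≡ true → c ≡ true) → ind b ≤ ind c
ind-mono {false} h = z≤n
ind-mono {true}  h rewrite h refl = ≤-refl

count-mono : ∀ {n} {p q : Fin n → Bool} → (∀ i → p i ≡ true → q i ≡ true) → count p ≤ count q
count-mono {p = p} {q} h rewrite count≡sumF p | count≡sumF q = sumF-mono (λ i → ind-mono (h i))

count-cong : ∀ {n} {p q : Fin n → Bool} → (∀ i → p i ≡ q i) → count p ≡ count q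
count-cong {zero}  h = refl
count-cong {suc n} {p} {q} h rewrite h fzero = cong (ind (q fzero) +_) (count-cong (λ i → h (fsuc i)))

count-strict : ∀ {n} {p q : Fin n → Bool} → (∀ i → p i ≡ true → q i ≡ true) →
               ∀ u → p u ≡ false → q u ≡ true → count p < count q
count-strict {p = p} {q} h u pu qu rewrite count≡sumF p | count≡sumF q =
  sumF-strict (λ i → ind-mono (h i)) u (subst₂ (λ a b → ind a < ind b) (sym pu) (sym qu) ≤-refl)

count-none : ∀ {n} (p : Fin n → Bool) → (∀ i → p i ≡ false) → count p ≡ 0
count-none {zero}  p h = refl
count-none {suc n} p h rewrite h fzero = count-none (λ i → p (fsuc i)) (λ i → h (fsuc i))

count-all : ∀ n → count {n} (λ _ → true) ≡ n
count-all zero    = refl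
count-all (suc n) = cong suc (count-all n)

count-< : ∀ {n} (p : Fin n → Bool) u → p u ≡ false → count p < n
count-< {n} p u pu = subst (count p <_) (count-all n) (count-strict (λ _ _ → refl) u pu refl)

count<⇒miss : ∀ {n} (p : Fin n → Bool) → count p < n → ∃ λ w → p w ≡ false
count<⇒miss {suc n} p lt with p fzero in eq
... | false = fzero , eq
... | true with count<⇒miss (λ i → p (fsuc i)) (≤-pred lt)
...   | w , pw = fsuc w , pw

count-witness : ∀ {n} (p : Fin n → Bool) → 0 < count p → ∃ λ x → p x ≡ true
count-witness {suc n} p pos with p fzero in eq
... | true  = fzero , eq
... | false with count-witness (λ i → p (fsuc i)) pos
...   | x , px = fsuc x , px

count-≤1 : ∀ {n} (p : Fin n → Bool) → (∀ i j → p i ≡ true → p j ≡ true → i ≡ j) → count p ≤ 1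
count-≤1 {zero}  p h = z≤n
count-≤1 {suc n} p h with p fzero in eq
... | true  = s≤s (≤-reflexive (count-none (λ i → p (fsuc i)) rest))
  where
    rest : ∀ i → p (fsuc i) ≡ false
    rest i with p (fsuc i) in eqᵢ
    ... | false = refl
    ... | true with h fzero (fsuc i) eq eqᵢ
    ...   | ()
... | false = count-≤1 (λ i → p (fsuc i)) (λ i j hi hj → fsuc-injective (h (fsuc i) (fsuc j) hi hj))

ind-∨ : ∀ a b → ind (a ∨ b) ≤ ind a + ind b
ind-∨ true  b = s≤s z≤n
ind-∨ false b = ≤-refl

count-∨ : ∀ {n} (p q : Fin n → Bool) → count (λ w → p w ∨ q w) ≤ count p + count q
count-∨ {zero}  p q = z≤n
count-∨ {suc n} p q = begin
  ind (p fzero ∨ q fzero) + count (λ w → p (fsuc w) ∨ q (fsuc w))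
    ≤⟨ +-mono-≤ (ind-∨ (p fzero) (q fzero)) (count-∨ (λ w → p (fsuc w)) (λ w → q (fsuc w))) ⟩
  (ind (p fzero) + ind (q fzero)) + (count (λ w → p (fsuc w)) + count (λ w → q (fsuc w)))
    ≡⟨ interchange (ind (p fzero)) (ind (q fzero)) _ _ ⟩
  count p + count q ∎
  where open ≤-Reasoning

count-anyF : ∀ {a n} (f : Fin a → Fin n → Bool) →
             count (λ w → anyF (λ i → f i w)) ≤ sumF (λ i → count (f i))
count-anyF {zero}  {n} f = ≤-reflexive (count-none {n} (λ _ → false) (λ _ → refl))
count-anyF {suc a} f = ≤-trans (count-∨ (f fzero) (λ w → anyF (λ i → f (fsuc i) w)))
                               (+-monoʳ-≤ (count (f fzero)) (count-anyF (λ i → f (fsuc i))))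

count-guarded : ∀ {a n} (g : Fin a → Bool) (f : Fin a → Fin n → Bool) (K : ℕ) →
                (∀ i → g i ≡ true → count (f i) ≤ K) →
                count (λ w → anyF (λ i → g i ∧ f i w)) ≤ count g * K
count-guarded {zero}  {n} g f K h = ≤-reflexive (count-none {n} (λ _ → false) (λ _ → refl))
count-guarded {suc a} g f K h with g fzero in eq
... | true  = ≤-trans (count-∨ (f fzero) _)
                      (+-mono-≤ (h fzero eq) (count-guarded (λ i → g (fsuc i)) (λ i → f (fsuc i)) K (λ i → h (fsuc i))))
... | false = count-guarded (λ i → g (fsuc i)) (λ i → f (fsuc i)) K (λ i → h (fsuc i))

K : ℕ → Graph
K N = record
  { V      = N
  ; adj    = λ x y → not (does (x ≟ᶠ y))
  ; symm   = λ x y → cong not (does-⇔ (mk⇔ sym sym) (x ≟ᶠ y) (y ≟ᶠ x))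
  ; irrefl = λ x → cong not (dec-true (x ≟ᶠ x) refl)
  }

K-adj : ∀ {N} {x y : Fin N} → x ≢ y → Adj (K N) x y
K-adj {x = x} {y} x≢y = cong not (dec-false (x ≟ᶠ y) x≢y)

K-maxDegree : ∀ D → MaxDegreeAtMost (K (suc D)) D
K-maxDegree D x = ≤-pred (count-< (adj (K (suc D)) x) x (irrefl (K (suc D)) x))

-- An injective self-map of Fin n is onto: a missed point x would let
-- punchOut x squeeze it into an injection Fin n → Fin (n - 1).
injective⇒surjective : ∀ {n} (σ : Fin n → Fin n) → Injective _≡_ _≡_ σ → ∀ x → ∃ λ i → σ i ≡ x
injective⇒surjective {suc n} σ σ-inj x with any? (λ i → σ i ≟ᶠ x)
... | yes hit = hit
... | no miss = contradiction (injective⇒≤ squeeze-injective) 1+n≰n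
  where
    squeeze : Fin (suc n) → Fin n
    squeeze i = punchOut {i = x} (λ x≡σi → miss (i , sym x≡σi))

    squeeze-injective : Injective _≡_ _≡_ squeeze
    squeeze-injective eq = σ-inj (punchOut-injective {i = x} _ _ eq)

asPermutation : ∀ {n} (σ : Fin n → Fin n) → Injective _≡_ _≡_ σ → Permutation n n
asPermutation σ σ-inj = permutation σ rank (λ x → proj₂ (onto x)) (λ i → σ-inj (proj₂ (onto (σ i))))
  where
    onto : ∀ x → ∃ λ i → σ i ≡ x
    onto = injective⇒surjective σ σ-inj

    rank : Fin _ → Fin _
    rank x = proj₁ (onto x)

adj-distinct : ∀ H {a b} → Adj H a b → a ≢ b
adj-distinct H {a} ab refl = true≢false (trans (sym ab) (irrefl H a))

orientedEdge : (H : Graph) → Fin (V H) → Fin (V H) → Bool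
orientedEdge H a b = (toℕ a <ᵇ toℕ b) ∧ adj H a b

orient : ∀ H {a b} → Adj H a b → orientedEdge H a b ≡ true ⊎ orientedEdge H b a ≡ true
orient H {a} {b} ab with <-cmp (toℕ a) (toℕ b)
... | tri< a<b _ _ = inj₁ (cong₂ _∧_ (dec-true (toℕ a <? toℕ b) a<b) ab)
... | tri≈ _ a≡b _ = ⊥-elim (adj-distinct H ab (toℕ-injective a≡b))
... | tri> _ _ b<a = inj₂ (cong₂ _∧_ (dec-true (toℕ b <? toℕ a) b<a) (trans (symm H b a) ab))

innerEdge : (H : Graph) → (Fin (V H) → Bool) → Fin (V H) → Fin (V H) → Bool
innerEdge H P a b = orientedEdge H a b ∧ (P a ∧ P b)

edgesInside : (H : Graph) → (Fin (V H) → Bool) → ℕ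
edgesInside H P = sumF (λ a → count (innerEdge H P a))

inner-outside : ∀ H P a b → P a ≡ false ⊎ P b ≡ false → innerEdge H P a b ≡ false
inner-outside H P a b (inj₁ pa) rewrite pa = ∧-zeroʳ (orientedEdge H a b)
inner-outside H P a b (inj₂ pb) rewrite pb | ∧-zeroʳ (P a) = ∧-zeroʳ (orientedEdge H a b)

edgesInside-< : ∀ H P a b → orientedEdge H a b ≡ true → innerEdge H P a b ≡ false → edgesInside H P < e H
edgesInside-< H P a b ab→ ab∉ =
  sumF-strict (λ a' → count-mono (inner⇒oriented a')) a (count-strict (inner⇒oriented a) b ab∉ ab→)
  where
    inner⇒oriented : ∀ a' b' → innerEdge H P a' b' ≡ true → orientedEdge H a' b' ≡ true
    inner⇒oriented a' b' = ∧-conicalˡ (orientedEdge H a' b') _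

edgesInside<e : ∀ H P {x y} → Adj H x y → P y ≡ false → edgesInside H P < e H
edgesInside<e H P {x} {y} xy y∉P with orient H xy
... | inj₁ xy→ = edgesInside-< H P x y xy→ (inner-outside H P x y (inj₂ y∉P))
... | inj₂ yx→ = edgesInside-< H P y x yx→ (inner-outside H P y x (inj₁ y∉P))

SameEdge : ∀ {A : Set} → A → A → A → A → Set
SameEdge x y x' y' = (x ≡ x' × y ≡ y') ⊎ (x ≡ y' × y ≡ x')

sameEdge-sym : ∀ {A : Set} {x y x' y' : A} → SameEdge x y x' y' → SameEdge x' y' x y
sameEdge-sym (inj₁ (refl , refl)) = inj₁ (refl , refl)
sameEdge-sym (inj₂ (refl , refl)) = inj₂ (refl , refl)

sameEdge-trans : ∀ {A : Set} {x y x' y' x'' y'' : A} →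
                 SameEdge x y x' y' → SameEdge x' y' x'' y'' → SameEdge x y x'' y''
sameEdge-trans (inj₁ (refl , refl)) s = s
sameEdge-trans (inj₂ (refl , refl)) (inj₁ (refl , refl)) = inj₂ (refl , refl)
sameEdge-trans (inj₂ (refl , refl)) (inj₂ (refl , refl)) = inj₁ (refl , refl)

module Embedding (H : Graph) {N : ℕ} (c : EdgeColouring (K N)) (proper : Proper c) where

  record PartialRainbow (P : Fin (V H) → Bool) : Set where
    field
      φ           : Fin (V H) → Fin N
      injectiveOn : ∀ x y → P x ≡ true → P y ≡ true → φ x ≡ φ y → x ≡ y
      rainbowOn   : ∀ x y x' y' → P x ≡ true → P y ≡ true → P x' ≡ true → P y' ≡ true →
                    Adj H x y → Adj H x' y' → col c (φ x) (φ y) ≡ col c (φ x') (φ y') → SameEdge x y x' y'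

  total⇒rainbowCopy : ∀ {P} → (∀ x → P x ≡ true) → PartialRainbow P → RainbowCopy H (K N) c
  total⇒rainbowCopy all emb = φ , injective , edges , rainbow
    where
      open PartialRainbow emb

      injective : Injective _≡_ _≡_ φ
      injective {x} {y} = injectiveOn x y (all x) (all y)

      edges : ∀ x y → Adj H x y → Adj (K N) (φ x) (φ y)
      edges x y xy = K-adj (λ φx≡φy → adj-distinct H xy (injective φx≡φy))

      rainbow : ∀ x y x' y' → Adj H x y → Adj H x' y' → col c (φ x) (φ y) ≡ col c (φ x') (φ y') →
                SameEdge x y x' y'
      rainbow x y x' y' = rainbowOn x y x' y' (all x) (all y) (all x') (all y')

  Fresh : (Fin (V H) → Bool) → (Fin (V H) → Fin N) → Fin N → Set
  Fresh P φ w = ∀ x → P x ≡ true → φ x ≢ w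

  Clashless : (Fin (V H) → Bool) → (Fin (V H) → Fin N) → Fin (V H) → Fin N → Set
  Clashless P φ u w = ∀ y a b → P y ≡ true → Adj H y u → P a ≡ true → P b ≡ true → Adj H a b →
                      col c (φ y) w ≢ col c (φ a) (φ b)

  extend : ∀ {P P'} (emb : PartialRainbow P) (u : Fin (V H)) → P u ≡ false →
           (∀ x → P' x ≡ true → P x ≡ true ⊎ x ≡ u) →
           (w : Fin N) → Fresh P (PartialRainbow.φ emb) w → Clashless P (PartialRainbow.φ emb) u w →
           PartialRainbow P'
  extend {P} {P'} emb u u∉P P'⊆P+u w fresh clashless =
    record { φ = φ' ; injectiveOn = injective' ; rainbowOn = rainbow' }
    where
      open PartialRainbow emb

      old≢u : ∀ {x} → P x ≡ true → x ≢ u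
      old≢u px refl = true≢false (trans (sym px) u∉P)

      w≢old : ∀ {z} → P z ≡ true → w ≢ φ z
      w≢old {z} pz w≡φz = fresh z pz (sym w≡φz)

      φ' : Fin (V H) → Fin N
      φ' x = if does (x ≟ᶠ u) then w else φ x

      φ'-new : φ' u ≡ w
      φ'-new rewrite dec-true (u ≟ᶠ u) refl = refl

      φ'-old : ∀ {x} → P x ≡ true → φ' x ≡ φ x
      φ'-old {x} px rewrite dec-false (x ≟ᶠ u) (old≢u px) = refl

      injective' : ∀ x y → P' x ≡ true → P' y ≡ true → φ' x ≡ φ' y → x ≡ y
      injective' x y px py eq with P'⊆P+u x px | P'⊆P+u y py
      ... | inj₁ ox   | inj₁ oy   = injectiveOn x y ox oy (trans (sym (φ'-old ox)) (trans eq (φ'-old oy)))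
      ... | inj₁ ox   | inj₂ refl = ⊥-elim (fresh x ox (trans (sym (φ'-old ox)) (trans eq φ'-new)))
      ... | inj₂ refl | inj₁ oy   = ⊥-elim (fresh y oy (trans (sym (φ'-old oy)) (trans (sym eq) φ'-new)))
      ... | inj₂ refl | inj₂ refl = refl

      data EdgeKind (x y : Fin (V H)) : Set where
        old : P x ≡ true → P y ≡ true → EdgeKind x y
        new : ∀ z → P z ≡ true → Adj H z u → SameEdge x y u z → EdgeKind x y

      classify : ∀ x y → P' x ≡ true → P' y ≡ true → Adj H x y → EdgeKind x y
      classify x y px py xy with P'⊆P+u x px | P'⊆P+u y py
      ... | inj₁ ox   | inj₁ oy   = old ox oy
      ... | inj₂ refl | inj₁ oy   = new y oy (trans (symm H y x) xy) (inj₁ (refl , refl))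
      ... | inj₁ ox   | inj₂ refl = new x ox xy (inj₂ (refl , refl))
      ... | inj₂ refl | inj₂ refl = ⊥-elim (adj-distinct H xy refl)

      oldColour : ∀ {x y} → P x ≡ true → P y ≡ true → col c (φ' x) (φ' y) ≡ col c (φ x) (φ y)
      oldColour ox oy = cong₂ (col c) (φ'-old ox) (φ'-old oy)

      newColour : ∀ {x y z} → P z ≡ true → SameEdge x y u z → col c (φ' x) (φ' y) ≡ col c (φ z) w
      newColour {z = z} pz (inj₁ (refl , refl)) =
        trans (cong₂ (col c) φ'-new (φ'-old pz)) (csym c w (φ z) (K-adj (w≢old pz)))
      newColour pz (inj₂ (refl , refl)) = cong₂ (col c) (φ'-old pz) φ'-new

      -- Properness at w: distinct embedded neighbours give w-edges of distinct colours.
      sameNeighbour : ∀ {z z'} → P z ≡ true → P z' ≡ true → col c (φ z) w ≡ col c (φ z') w → z ≡ z'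
      sameNeighbour {z} {z'} pz pz' eq with z ≟ᶠ z'
      ... | yes z≡z' = z≡z'
      ... | no z≢z'  = ⊥-elim (proper w (φ z) (φ z') (K-adj (w≢old pz)) (K-adj (w≢old pz'))
                         (λ e → z≢z' (injectiveOn z z' pz pz' e))
                         (trans (csym c w (φ z) (K-adj (w≢old pz)))
                                (trans eq (csym c (φ z') w (K-adj (λ e → w≢old pz' (sym e)))))))

      rainbow' : ∀ x y x' y' → P' x ≡ true → P' y ≡ true → P' x' ≡ true → P' y' ≡ true →
                 Adj H x y → Adj H x' y' → col c (φ' x) (φ' y) ≡ col c (φ' x') (φ' y') → SameEdge x y x' y'
      rainbow' x y x' y' px py px' py' xy x'y' eq
        with classify x y px py xy | classify x' y' px' py' x'y'
      ... | old ox oy | old ox' oy' =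
        rainbowOn x y x' y' ox oy ox' oy' xy x'y' (trans (sym (oldColour ox oy)) (trans eq (oldColour ox' oy')))
      ... | old ox oy | new z pz zu e' =
        ⊥-elim (clashless z x y pz zu ox oy xy (trans (sym (newColour pz e')) (trans (sym eq) (oldColour ox oy))))
      ... | new z pz zu e | old ox' oy' =
        ⊥-elim (clashless z x' y' pz zu ox' oy' x'y' (trans (sym (newColour pz e)) (trans eq (oldColour ox' oy'))))
      ... | new z pz _ e | new z' pz' _ e'
        with refl ← sameNeighbour pz pz' (trans (sym (newColour pz e)) (trans eq (newColour pz' e'))) =
        sameEdge-trans e (sameEdge-sym e')

  module Candidates {P : Fin (V H) → Bool} (emb : PartialRainbow P) (u : Fin (V H)) where
    open PartialRainbow emb

    earlierNeighbour : Fin (V H) → Bool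
    earlierNeighbour y = P y ∧ adj H y u

    used : Fin N → Bool
    used w = anyF (λ x → P x ∧ does (φ x ≟ᶠ w))

    repeats : Fin (V H) → Fin (V H) → Fin (V H) → Fin N → Bool
    repeats y a b w = not (does (w ≟ᶠ φ y)) ∧ does (col c (φ y) w ≟ col c (φ a) (φ b))

    clashesVia : Fin (V H) → Fin N → Bool
    clashesVia y w = anyF (λ a → anyF (λ b → innerEdge H P a b ∧ repeats y a b w))

    clashing : Fin N → Bool
    clashing w = anyF (λ y → earlierNeighbour y ∧ clashesVia y w)

    bad : Fin N → Bool
    bad w = used w ∨ clashing w

    -- Properness at φ(y): at most one w makes φ(y)w repeat a given colour.
    repeats-≤1 : ∀ y a b → count (repeats y a b) ≤ 1
    repeats-≤1 y a b = count-≤1 (repeats y a b) unique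
      where
        away : ∀ {w} → repeats y a b w ≡ true → φ y ≢ w
        away {w} r φy≡w = ¬does⇒ (w ≟ᶠ φ y) (not-true (∧-conicalˡ _ _ r)) (sym φy≡w)

        colour : ∀ {w} → repeats y a b w ≡ true → col c (φ y) w ≡ col c (φ a) (φ b)
        colour {w} r = does⇒ (col c (φ y) w ≟ col c (φ a) (φ b)) (∧-conicalʳ _ _ r)

        unique : ∀ w w' → repeats y a b w ≡ true → repeats y a b w' ≡ true → w ≡ w'
        unique w w' r r' with w ≟ᶠ w'
        ... | yes w≡w' = w≡w'
        ... | no w≢w'  = ⊥-elim (proper (φ y) w w' (K-adj (away r)) (K-adj (away r')) w≢w'
                                   (trans (colour r) (sym (colour r'))))

    used-count : count used ≤ count P
    used-count = ≤-trans (count-guarded P (λ x w → does (φ x ≟ᶠ w)) 1 (λ x _ → count-≤1 _ (hit-once x)))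
                         (≤-reflexive (*-identityʳ (count P)))
      where
        hit-once : ∀ x w w' → does (φ x ≟ᶠ w) ≡ true → does (φ x ≟ᶠ w') ≡ true → w ≡ w'
        hit-once x w w' h h' = trans (sym (does⇒ (φ x ≟ᶠ w) h)) (does⇒ (φ x ≟ᶠ w') h')

    clashing-count : count clashing ≤ count earlierNeighbour * edgesInside H P
    clashing-count = count-guarded earlierNeighbour clashesVia (edgesInside H P) (λ y _ → per-neighbour y)
      where
        per-neighbour : ∀ y → count (clashesVia y) ≤ edgesInside H P
        per-neighbour y = ≤-trans (count-anyF (λ a w → anyF (λ b → innerEdge H P a b ∧ repeats y a b w))) (sumF-mono λ a →
          ≤-trans (count-guarded (innerEdge H P a) (λ b → repeats y a b) 1 (λ b _ → repeats-≤1 y a b))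
                  (≤-reflexive (*-identityʳ (count (innerEdge H P a)))))

    bad-count : count bad ≤ count P + count earlierNeighbour * edgesInside H P
    bad-count = ≤-trans (count-∨ used clashing) (+-mono-≤ used-count clashing-count)

    good⇒admissible : ∀ w → bad w ≡ false → Fresh P φ w × Clashless P φ u w
    good⇒admissible w bad≡false = fresh , clashless
      where
        fresh : Fresh P φ w
        fresh x px = ¬does⇒ (φ x ≟ᶠ w)
          (subst (λ t → t ∧ does (φ x ≟ᶠ w) ≡ false) px (anyF-false _ (∨-conicalˡ (used w) _ bad≡false) x))

        noRepeat : ∀ y a b → earlierNeighbour y ≡ true → innerEdge H P a b ≡ true →
                   col c (φ y) w ≢ col c (φ a) (φ b)
        noRepeat y a b ny ab = ¬does⇒ (col c (φ y) w ≟ col c (φ a) (φ b)) different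
          where
            ignored : clashesVia y w ≡ false
            ignored = subst (λ t → t ∧ clashesVia y w ≡ false) ny
                            (anyF-false _ (∨-conicalʳ (used w) _ bad≡false) y)

            noRepeat-ab : repeats y a b w ≡ false
            noRepeat-ab = subst (λ t → t ∧ repeats y a b w ≡ false) ab (anyF-false _ (anyF-false _ ignored a) b)

            w≢φy : does (w ≟ᶠ φ y) ≡ false
            w≢φy = dec-false (w ≟ᶠ φ y) (λ w≡φy → fresh y (∧-conicalˡ _ _ ny) (sym w≡φy))

            different : does (col c (φ y) w ≟ col c (φ a) (φ b)) ≡ false
            different = subst (λ t → not t ∧ does (col c (φ y) w ≟ col c (φ a) (φ b)) ≡ false) w≢φy noRepeat-ab

        clashless : Clashless P φ u w
        clashless y a b py yu pa pb ab with orient H ab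
        ... | inj₁ ab→ = noRepeat y a b (cong₂ _∧_ py yu) (cong₂ _∧_ ab→ (cong₂ _∧_ pa pb))
        ... | inj₂ ba→ = λ eq → noRepeat y b a (cong₂ _∧_ py yu) (cong₂ _∧_ ba→ (cong₂ _∧_ pb pa))
                                  (trans eq (csym c (φ a) (φ b) (K-adj φa≢φb)))
          where
            φa≢φb : φ a ≢ φ b
            φa≢φb e = adj-distinct H ab (injectiveOn a b pa pb e)

pred≡∸1 : ∀ e → pred e ≡ e ∸ 1
pred≡∸1 zero    = refl
pred≡∸1 (suc e) = refl

product-bound : ∀ {c E} k e → c ≤ k → (0 < c → E < e) → c * E ≤ k * e ∸ k
product-bound {zero}      k e _   _   = z≤n
product-bound {suc c} {E} k e c≤k E<e = begin
  suc c * E     ≤⟨ *-mono-≤ c≤k (<⇒≤pred (E<e z<s)) ⟩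
  k * pred e    ≡⟨ cong (k *_) (pred≡∸1 e) ⟩
  k * (e ∸ 1)   ≡⟨ *-distribˡ-∸ k e 1 ⟩
  k * e ∸ k * 1 ≡⟨ cong (k * e ∸_) (*-identityʳ k) ⟩
  k * e ∸ k     ∎
  where open ≤-Reasoning

budget : ∀ {U X} n B → U < n → X ≤ B → U + X ≤ B + n ∸ 1
budget {U} {X} (suc n) B (s≤s U≤n) X≤B rewrite +-suc B n =
  ≤-trans (+-mono-≤ U≤n X≤B) (≤-reflexive (+-comm n B))

module Greedy (H : Graph) (k : ℕ) (σ : Fin (V H) → Fin (V H)) (σ-inj : Injective _≡_ _≡_ σ)
  (degenerate : ∀ i → count (λ j → (toℕ j <ᵇ toℕ i) ∧ adj H (σ j) (σ i)) ≤ k) where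

  D : ℕ
  D = k * e H ∸ k + V H ∸ 1

  ρ : Permutation (V H) (V H)
  ρ = asPermutation σ σ-inj

  -- position of a vertex in the ordering
  rank : Fin (V H) → Fin (V H)
  rank x = ρ ⟨$⟩ˡ x

  rank-injective : Injective _≡_ _≡_ rank
  rank-injective {x} {y} eq = trans (sym (inverseʳ ρ)) (trans (cong σ eq) (inverseʳ ρ))

  first : ℕ → Fin (V H) → Bool
  first m x = does (toℕ (rank x) <? m)

  module _ (c : EdgeColouring (K (suc D))) (proper : Proper c) where
    open Embedding H c proper

    -- Embedding the (m+1)-st vertex u = σ m: fewer than v(H) images are used
    -- and, as u has at most k embedded neighbours, each clashing with fewer
    -- than e(H) embedded edges in at most one image, an admissible image exists.
    step : ∀ m (m<n : m < V H) → PartialRainbow (first m) → PartialRainbow (first (suc m))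
    step m m<n emb = extend emb u u-new split w (proj₁ admissible) (proj₂ admissible)
      where
        i₀ : Fin (V H)
        i₀ = fromℕ< m<n

        u : Fin (V H)
        u = σ i₀

        open Candidates emb u

        rank-u : toℕ (rank u) ≡ m
        rank-u = trans (cong toℕ (inverseˡ ρ)) (toℕ-fromℕ< m<n)

        u-new : first m u ≡ false
        u-new = dec-false (toℕ (rank u) <? m) (<-irrefl rank-u)

        split : ∀ x → first (suc m) x ≡ true → first m x ≡ true ⊎ x ≡ u
        split x h with m≤n⇒m<n∨m≡n (≤-pred (does⇒ (toℕ (rank x) <? suc m) h))
        ... | inj₁ lt = inj₁ (dec-true (toℕ (rank x) <? m) lt)
        ... | inj₂ eq = inj₂ (rank-injective (toℕ-injective (trans eq (sym rank-u))))

        earlier-count : count earlierNeighbour ≤ k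
        earlier-count = begin
          count earlierNeighbour                                 ≡⟨ count-permute earlierNeighbour ρ ⟩
          count (λ j → earlierNeighbour (σ j))                   ≡⟨ count-cong reindex ⟩
          count (λ j → (toℕ j <ᵇ toℕ i₀) ∧ adj H (σ j) (σ i₀))   ≤⟨ degenerate i₀ ⟩
          k                                                      ∎
          where
            open ≤-Reasoning
            reindex : ∀ j → earlierNeighbour (σ j) ≡ ((toℕ j <ᵇ toℕ i₀) ∧ adj H (σ j) (σ i₀))
            reindex j = cong₂ (λ s t → (s <ᵇ t) ∧ adj H (σ j) u) (cong toℕ (inverseˡ ρ)) (sym (toℕ-fromℕ< m<n))

        inside<e : 0 < count earlierNeighbour → edgesInside H (first m) < e H
        inside<e pos with y , ny ← count-witness earlierNeighbour pos =
          edgesInside<e H (first m) (∧-conicalʳ (first m y) _ ny) u-new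

        few-bad : count bad < suc D
        few-bad = s≤s (≤-trans bad-count
          (budget (V H) (k * e H ∸ k) (count-< (first m) u u-new) (product-bound k (e H) earlier-count inside<e)))

        w : Fin (suc D)
        w = proj₁ (count<⇒miss bad few-bad)

        admissible : Fresh (first m) (PartialRainbow.φ emb) w × Clashless (first m) (PartialRainbow.φ emb) u w
        admissible = good⇒admissible w (proj₂ (count<⇒miss bad few-bad))

    build : ∀ m → m ≤ V H → PartialRainbow (first m)
    build zero    _   = record { φ = λ _ → fzero ; injectiveOn = λ _ _ () ; rainbowOn = λ _ _ _ _ () }
    build (suc m) m<n = step m m<n (build m (<⇒≤ m<n))

    rainbowCopy : RainbowCopy H (K (suc D)) c
    rainbowCopy = total⇒rainbowCopy (λ x → dec-true (toℕ (rank x) <? V H) (toℕ<n (rank x))) (build (V H) ≤-refl)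

corollary1p2 : (H : Graph) (k : ℕ) → IsDegeneracy H k →
    ARdAtMost H (k * e H ∸ k + v H ∸ 1)
corollary1p2 H k ((σ , σ-inj , degenerate) , _) = K (suc D) , K-maxDegree D , rainbowCopy
  where open Greedy H k σ σ-inj degenerate
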